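{- Let $X$ be a finite set of clocks, $\alpha:X\to\mathbb{N}$, $R$ a region with respect to $\alpha$ with canonical distance graph $G_R$, and let $x_1,x_2\in X$ be clocks bounded in $R$. Let $G$ be any distance graph on $X\cup\{x_0\}$. If the weight of the edge $x_1\to x_2$ in $G$ is strictly smaller than its weight in $G_R$ (so that in $\min(G_R,G)$ this weight comes from $G$), then $x_1\to x_2\to x_1$ is a negative cycle in $\min(G_R,G)$.
   Context: Weights are pairs $(\preccurlyeq,c)$, $\preccurlyeq\in\{\le,<\}$, $c\in\mathbb{Z}\cup\{\infty\}$, ordered by $(\preccurlyeq_1,c_1)<(\preccurlyeq_2,c_2)$ iff $c_1<c_2$ or ($c_1=c_2$, $\preccurlyeq_1$ is $<$, $\preccurlyeq_2$ is $\le$), with addition $(\preccurlyeq_1,c_1)+(\preccurlyeq_2,c_2)=(\preccurlyeq,c_1+c_2)$, $\preccurlyeq$ strict iff one summand is strict. A distance graph has vertices $X\cup\{x_0\}$ ($x_0$ a special clock equal to $0$) and an edge $x\to y$ of weight $(\preccurlyeq,c)$ for each ordered pair, representing $y-x\preccurlyeq c$. A cycle is negative if its total weight is $\le(<,0)$. $\min(G_1,G_2)$ is the distance graph whose edge weights are the minima of the corresponding weights in $G_1$ and $G_2$. A region w.r.t. $\alpha$ is specified by: for each clock $x$ one constraint among $x=c$ ($c=0,\dots,\alpha_x$), $c-1<x<c$ ($c=1,\dots,\alpha_x$), $x>\alpha_x$; and for each pair of clocks in open unit intervals, the ordering of their fractional parts. $G_R$ is the canonical distance graph (every edge weight equals the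 least weight of a path between its endpoints) representing the constraints of $R$. A clock $x$ is bounded in $R$ if $x\le c$ holds in $R$ for some constant $c$. -}

module Defs where

open import Data.Bool using (Bool; true; false; if_then_else_; _∧_; _∨_)
open import Data.Nat as ℕ using (ℕ; suc; _∸_)
open import Data.Integer as ℤ using (ℤ; +_; -_; _-_)
open import Data.Fin as Fin using (Fin; zero; suc)
open import Data.List using (List; []; _∷_)
open import Data.Product using (Σ; _×_; _,_)
open import Relation.Nullary.Decidable using (⌊_⌋)
open import Relation.Binary.PropositionalEquality using (_≡_)
open import Data.Sum using (_⊎_)

data Rel : Set where
  le lt : Rel

data ℤ∞ : Set where
  fin : ℤ → ℤ∞
  ∞   : ℤ∞

data Weight : Set where
  w : Rel → ℤ∞ → Weight

data _<∞_ : ℤ∞ → ℤ∞ → Set where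
  fin<fin : ∀ {a b} → a ℤ.< b → fin a <∞ fin b
  fin<∞   : ∀ {a} → fin a <∞ ∞

data _<ʷ_ : Weight → Weight → Set where
  <-const : ∀ {r₁ r₂ c₁ c₂} → c₁ <∞ c₂ → w r₁ c₁ <ʷ w r₂ c₂
  <-rel   : ∀ {c} → w lt c <ʷ w le c

_≤ʷ_ : Weight → Weight → Set
a ≤ʷ b = a <ʷ b ⊎ a ≡ b

_+ʳ_ : Rel → Rel → Rel
le +ʳ le = le
_  +ʳ _  = lt

_+∞_ : ℤ∞ → ℤ∞ → ℤ∞
fin a +∞ fin b = fin (a ℤ.+ b)
_     +∞ _     = ∞

_+ʷ_ : Weight → Weight → Weight
w r₁ c₁ +ʷ w r₂ c₂ = w (r₁ +ʳ r₂) (c₁ +∞ c₂)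

lt∞ᵇ : ℤ∞ → ℤ∞ → Bool
lt∞ᵇ (fin a) (fin b) = ⌊ a ℤ.<? b ⌋
lt∞ᵇ (fin a) ∞       = true
lt∞ᵇ ∞       _       = false

eq∞ᵇ : ℤ∞ → ℤ∞ → Bool
eq∞ᵇ (fin a) (fin b) = ⌊ a ℤ.≟ b ⌋
eq∞ᵇ ∞       ∞       = true
eq∞ᵇ _       _       = false

isLt : Rel → Bool
isLt lt = true
isLt le = false

isLe : Rel → Bool
isLe le = true
isLe lt = false

_<ʷᵇ_ : Weight → Weight → Bool
w r₁ c₁ <ʷᵇ w r₂ c₂ = lt∞ᵇ c₁ c₂ ∨ (eq∞ᵇ c₁ c₂ ∧ (isLt r₁ ∧ isLe r₂))

minʷ : Weight → Weight → Weight
minʷ a b = if b <ʷᵇ a then b else a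

-- Distance graphs over X ∪ {x₀}, with X = Fin n; vertex zero is x₀
-- and clock x is vertex suc x.  An edge u → v of weight (≼,c) means v - u ≼ c.

Vertex : ℕ → Set
Vertex n = Fin (suc n)

Graph : ℕ → Set
Graph n = Vertex n → Vertex n → Weight

minG : ∀ {n} → Graph n → Graph n → Graph n
minG G₁ G₂ u v = minʷ (G₁ u v) (G₂ u v)

pathWeight : ∀ {n} → Graph n → Vertex n → List (Vertex n) → Vertex n → Weight
pathWeight G u []       v = G u v
pathWeight G u (m ∷ ms) v = G u m +ʷ pathWeight G m ms v

IsLeastPathWeight : ∀ {n} → Graph n → Vertex n → Vertex n → Weight → Set
IsLeastPathWeight G u v c =
  Σ (List (Vertex _)) (λ ms → pathWeight G u ms v ≡ c)
  × (∀ ms → c ≤ʷ pathWeight G u ms v)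

IsCanonicalOf : ∀ {n} → Graph n → Graph n → Set
IsCanonicalOf G G' = ∀ u v → IsLeastPathWeight G u v (G' u v)

NegativeCycle2 : ∀ {n} → Graph n → Vertex n → Vertex n → Set
NegativeCycle2 G x y = (G x y +ʷ G y x) ≤ʷ w lt (fin (+ 0))

data ClockCon (a : ℕ) : Set where
  eqc   : (c : ℕ) → c ℕ.≤ a → ClockCon a
  openc : (c : ℕ) → 1 ℕ.≤ c → c ℕ.≤ a → ClockCon a       -- c-1 < x < c
  above : ClockCon a                                      -- x > a

-- A region: a constraint for every clock, and a total preorder on the
-- fractional parts of the clocks lying in open unit intervals, given by a
-- rank function (frac x < frac y iff rank x < rank y; equal iff ranks equal).
-- Ranks of clocks not in open intervals are irrelevant.
record Region {n : ℕ} (α : Fin n → ℕ) : Set where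
  field
    con  : (x : Fin n) → ClockCon (α x)
    rank : Fin n → ℕ

data Bounded {n} {α : Fin n → ℕ} (R : Region α) (x : Fin n) : Set where
  bnd-eq   : ∀ c p → Region.con R x ≡ eqc c p → Bounded R x
  bnd-open : ∀ c p q → Region.con R x ≡ openc c p q → Bounded R x

data OpenInfo : Set where
  inOpen : ℕ → OpenInfo
  notOpen : OpenInfo

openInfo : ∀ {a} → ClockCon a → OpenInfo
openInfo (openc c _ _) = inOpen c
openInfo _             = notOpen

constraintGraph : ∀ {n} {α : Fin n → ℕ} → Region α → Graph n
constraintGraph {α = α} R = G
  where
  open Region R
  upper : ∀ {a} → ClockCon a → Weight
  upper (eqc c _)     = w le (fin (+ c))
  upper (openc c _ _) = w lt (fin (+ c))
  upper above         = w lt ∞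
  lower : (x : Fin _) → ClockCon (α x) → Weight
  lower x (eqc c _)     = w le (fin (- (+ c)))
  lower x (openc c _ _) = w lt (fin (- (+ (c ∸ 1))))
  lower x above         = w lt (fin (- (+ α x)))
  -- edge x → y (y - x ≼ c) from the ordering of fractional parts,
  -- x ∈ (a-1,a), y ∈ (b-1,b):  y - x = (b - a) + (frac y - frac x)
  diag : Fin _ → Fin _ → OpenInfo → OpenInfo → Weight
  diag x y (inOpen a) (inOpen b) =
    if ⌊ rank y ℕ.<? rank x ⌋ then w lt (fin (+ b - + a))
    else if ⌊ rank y ℕ.≟ rank x ⌋ then w le (fin (+ b - + a))
    else w lt ∞
  diag x y _ _ = w lt ∞
  G : Graph _
  G zero    zero    = w le (fin (+ 0))
  G zero    (suc y) = upper (con y)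
  G (suc x) zero    = lower x (con x)
  G (suc x) (suc y) =
    if ⌊ x Fin.≟ y ⌋ then w le (fin (+ 0))
    else diag x y (openInfo (con x)) (openInfo (con y))

module Submission where

open import Defs
open import Data.Nat using (ℕ)
open import Data.Fin using (Fin; suc)

open import Data.Bool using (T; true; false)
open import Data.Bool.Properties using (T-∨; T-∧)
open import Data.Nat as ℕ using (s≤s; z≤n)
import Data.Nat.Properties as ℕ
open import Data.Fin as Fin using (zero)
open import Data.Integer as ℤ using (ℤ; +_; -_; _-_)
import Data.Integer.Properties as ℤ
open import Data.Integer.Tactic.RingSolver using (solve-∀)
open import Data.List using (List; []; _∷_)
open import Data.Product using (_,_; proj₂)
open import Data.Sum using (inj₁; inj₂)
open import Function using (_∘_)
open import Function.Bundles using (Equivalence)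
open import Relation.Binary.Definitions using (tri<; tri≈; tri>)
open import Relation.Binary.PropositionalEquality
open import Relation.Nullary using (yes; no; contradiction)
open import Relation.Nullary.Decidable using (toWitness; fromWitness)

-- For bounded clocks x₁, x₂ the constraint graph of R has paths x₁ ⇝ x₂ and
-- x₂ ⇝ x₁ (through x₀, or along the edge given by the ordering of fractional
-- parts when both clocks lie in open intervals) of one strictness whose weights
-- add up to exactly (≤,0) or (<,1).  With integer constants these are the least
-- weights of their strictness above (<,0), so anything strictly below the first
-- path plus anything at most the second is ≤ (<,0).  Canonicity of G_R bounds
-- the two edges of min(G_R,G) in exactly this way.

<∞-trans : ∀ {a b c} → a <∞ b → b <∞ c → a <∞ c
<∞-trans (fin<fin a<b) (fin<fin b<c) = fin<fin (ℤ.<-trans a<b b<c)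
<∞-trans (fin<fin _)   fin<∞         = fin<∞

<ʷ-trans : ∀ {a b c} → a <ʷ b → b <ʷ c → a <ʷ c
<ʷ-trans (<-const a<b) (<-const b<c) = <-const (<∞-trans a<b b<c)
<ʷ-trans (<-const a<b) <-rel         = <-const a<b
<ʷ-trans <-rel         (<-const b<c) = <-const b<c

<ʷ-≤ʷ-trans : ∀ {a b c} → a <ʷ b → b ≤ʷ c → a <ʷ c
<ʷ-≤ʷ-trans a<b (inj₁ b<c)  = <ʷ-trans a<b b<c
<ʷ-≤ʷ-trans a<b (inj₂ refl) = a<b

≤ʷ-trans : ∀ {a b c} → a ≤ʷ b → b ≤ʷ c → a ≤ʷ c
≤ʷ-trans (inj₁ a<b)  b≤c = inj₁ (<ʷ-≤ʷ-trans a<b b≤c)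
≤ʷ-trans (inj₂ refl) b≤c = b≤c

+ʷ-monoʳ-≤ : ∀ t e {b b′} → b ≤ʷ b′ → (w t (fin e) +ʷ b) ≤ʷ (w t (fin e) +ʷ b′)
+ʷ-monoʳ-≤ t  e (inj₂ refl)                   = inj₂ refl
+ʷ-monoʳ-≤ t  e (inj₁ (<-const (fin<fin b<b′))) = inj₁ (<-const (fin<fin (ℤ.+-monoʳ-< e b<b′)))
+ʷ-monoʳ-≤ t  e (inj₁ (<-const fin<∞))         = inj₁ (<-const fin<∞)
+ʷ-monoʳ-≤ le e (inj₁ <-rel)                   = inj₁ <-rel
+ʷ-monoʳ-≤ lt e (inj₁ <-rel)                   = inj₂ refl

+ʳ-zeroʳ : ∀ r → r +ʳ lt ≡ lt
+ʳ-zeroʳ le = refl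
+ʳ-zeroʳ lt = refl

lt∞ᵇ-sound : ∀ c₁ c₂ → T (lt∞ᵇ c₁ c₂) → c₁ <∞ c₂
lt∞ᵇ-sound (fin a) (fin b) a<b = fin<fin (toWitness a<b)
lt∞ᵇ-sound (fin a) ∞       _   = fin<∞

eq∞ᵇ-sound : ∀ c₁ c₂ → T (eq∞ᵇ c₁ c₂) → c₁ ≡ c₂
eq∞ᵇ-sound (fin a) (fin b) a≡b = cong fin (toWitness a≡b)
eq∞ᵇ-sound ∞       ∞       _   = refl

<ʷᵇ-sound : ∀ a b → T (a <ʷᵇ b) → a <ʷ b
<ʷᵇ-sound (w r₁ c₁) (w r₂ c₂) a<b with Equivalence.to (T-∨ {lt∞ᵇ c₁ c₂}) a<b
... | inj₁ c₁<c₂ = <-const (lt∞ᵇ-sound c₁ c₂ c₁<c₂)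
... | inj₂ c₁≡c₂∧rels with Equivalence.to (T-∧ {eq∞ᵇ c₁ c₂}) c₁≡c₂∧rels
<ʷᵇ-sound (w lt c₁) (w le c₂) _ | inj₂ _ | c₁≡c₂ , _
  rewrite eq∞ᵇ-sound c₁ c₂ c₁≡c₂ = <-rel
<ʷᵇ-sound (w le c₁) (w le c₂) _ | inj₂ _ | _ , ()
<ʷᵇ-sound (w le c₁) (w lt c₂) _ | inj₂ _ | _ , ()
<ʷᵇ-sound (w lt c₁) (w lt c₂) _ | inj₂ _ | _ , ()

<ʷᵇ-complete : ∀ {a b} → a <ʷ b → T (a <ʷᵇ b)
<ʷᵇ-complete (<-const (fin<fin {a} {b} a<b)) =
  Equivalence.from (T-∨ {lt∞ᵇ (fin a) (fin b)}) (inj₁ (fromWitness a<b))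
<ʷᵇ-complete (<-const fin<∞)         = _
<ʷᵇ-complete (<-rel {fin c})         =
  Equivalence.from (T-∨ {lt∞ᵇ (fin c) (fin c)})
    (inj₂ (Equivalence.from (T-∧ {eq∞ᵇ (fin c) (fin c)}) (fromWitness refl , _)))
<ʷᵇ-complete (<-rel {∞})             = _

minʷ-≤ˡ : ∀ a b → minʷ a b ≤ʷ a
minʷ-≤ˡ a b with b <ʷᵇ a | <ʷᵇ-sound b a
... | true  | b<a = inj₁ (b<a _)
... | false | _   = inj₂ refl

<ʷ⇒minʷ≡ʳ : ∀ {a b} → b <ʷ a → minʷ a b ≡ b
<ʷ⇒minʷ≡ʳ {a} {b} b<a with b <ʷᵇ a | <ʷᵇ-complete b<a
... | true | _ = refl

slack : Rel → ℤ
slack le = + 0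
slack lt = + 1

tight-undercut-negative : ∀ r {p q t e} → p ℤ.+ q ≡ slack r
                        → w t (fin e) <ʷ w r (fin p)
                        → (w t (fin e) +ʷ w r (fin q)) ≤ʷ w lt (fin (+ 0))
tight-undercut-negative le {q = q} p+q≡0 (<-const (fin<fin e<p)) =
  inj₁ (<-const (fin<fin (subst (ℤ._<_ _) p+q≡0 (ℤ.+-monoˡ-< q e<p))))
tight-undercut-negative le p+q≡0 <-rel = inj₂ (cong (λ c → w lt (fin c)) p+q≡0)
tight-undercut-negative lt {q = q} {t} {e} p+q≡1 (<-const (fin<fin e<p))
  rewrite +ʳ-zeroʳ t with e ℤ.+ q ℤ.≟ + 0
... | yes e+q≡0 = inj₂ (cong (λ c → w lt (fin c)) e+q≡0)
... | no  e+q≢0 = inj₁ (<-const (fin<fin (ℤ.≤∧≢⇒< e+q≤0 e+q≢0)))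
  where
  e+q≤0 : e ℤ.+ q ℤ.≤ + 0
  e+q≤0 = ℤ.i<j⇒i≤pred[j] (subst (ℤ._<_ _) p+q≡1 (ℤ.+-monoˡ-< q e<p))

tight-undercut-negative-≤ : ∀ r {p q a b} → p ℤ.+ q ≡ slack r
                          → a <ʷ w r (fin p) → b ≤ʷ w r (fin q)
                          → (a +ʷ b) ≤ʷ w lt (fin (+ 0))
tight-undercut-negative-≤ r {a = w t (fin e)} p+q≡slack a<P b≤Q =
  ≤ʷ-trans (+ʷ-monoʳ-≤ t e b≤Q) (tight-undercut-negative r p+q≡slack a<P)
tight-undercut-negative-≤ r {a = w t ∞} _ (<-const ()) _

record TightCycle {n} (G : Graph n) (u v : Vertex n) : Set where
  constructor tight
  field
    strictness : Rel
    out back   : List (Vertex n)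
    p q        : ℤ
    out-weight  : pathWeight G u out v ≡ w strictness (fin p)
    back-weight : pathWeight G v back u ≡ w strictness (fin q)
    p+q≡slack   : p ℤ.+ q ≡ slack strictness

TightCycle-swap : ∀ {n} {G : Graph n} {u v} → TightCycle G u v → TightCycle G v u
TightCycle-swap (tight r out back p q out-weight back-weight p+q≡slack) =
  tight r back out q p back-weight out-weight (trans (ℤ.+-comm q p) p+q≡slack)

TightCycle⇒negativeCycle2 : ∀ {n} {CG GR : Graph n} {u v}
                          → IsCanonicalOf CG GR → TightCycle CG u v → (G : Graph n)
                          → G u v <ʷ GR u v → NegativeCycle2 (minG GR G) u v
TightCycle⇒negativeCycle2 {CG = CG} {GR} {u} {v} canonical
  (tight r out back p q out-weight back-weight p+q≡slack) G G<GR =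
  tight-undercut-negative-≤ r p+q≡slack min<out min≤back
  where
  GR≤pathWeight : ∀ x y ms → GR x y ≤ʷ pathWeight CG x ms y
  GR≤pathWeight x y = proj₂ (canonical x y)

  min<out : minG GR G u v <ʷ w r (fin p)
  min<out rewrite <ʷ⇒minʷ≡ʳ G<GR =
    <ʷ-≤ʷ-trans G<GR (subst (GR u v ≤ʷ_) out-weight (GR≤pathWeight u v out))

  min≤back : minG GR G v u ≤ʷ w r (fin q)
  min≤back = ≤ʷ-trans (minʷ-≤ˡ (GR v u) (G v u))
                      (subst (GR v u ≤ʷ_) back-weight (GR≤pathWeight v u back))

module _ {n} {α : Fin n → ℕ} (R : Region α) where
  open Region R

  private
    CG : Graph n
    CG = constraintGraph R

  lower-eqc : ∀ {x c p} → con x ≡ eqc c p → CG (suc x) zero ≡ w le (fin (- (+ c)))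
  lower-eqc eq rewrite eq = refl

  upper-eqc : ∀ {x c p} → con x ≡ eqc c p → CG zero (suc x) ≡ w le (fin (+ c))
  upper-eqc eq rewrite eq = refl

  lower-openc : ∀ {x c p q} → con x ≡ openc (ℕ.suc c) p q → CG (suc x) zero ≡ w lt (fin (- (+ c)))
  lower-openc eq rewrite eq = refl

  upper-openc : ∀ {x c p q} → con x ≡ openc (ℕ.suc c) p q → CG zero (suc x) ≡ w lt (fin (+ ℕ.suc c))
  upper-openc eq rewrite eq = refl

  diagonal-refl : ∀ x → CG (suc x) (suc x) ≡ w le (fin (+ 0))
  diagonal-refl x with x Fin.≟ x
  ... | yes _  = refl
  ... | no x≢x = contradiction refl x≢x

  diagonal-< : ∀ {x y a b pa qa pb qb} → con x ≡ openc a pa qa → con y ≡ openc b pb qb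
             → x ≢ y → rank y ℕ.< rank x → CG (suc x) (suc y) ≡ w lt (fin (+ b - + a))
  diagonal-< {x} {y} eqx eqy x≢y y<x rewrite eqx | eqy with x Fin.≟ y
  ... | yes x≡y = contradiction x≡y x≢y
  ... | no _ with rank y ℕ.<? rank x
  ... | yes _  = refl
  ... | no y≮x = contradiction y<x y≮x

  diagonal-≡ : ∀ {x y a b pa qa pb qb} → con x ≡ openc a pa qa → con y ≡ openc b pb qb
             → x ≢ y → rank y ≡ rank x → CG (suc x) (suc y) ≡ w le (fin (+ b - + a))
  diagonal-≡ {x} {y} eqx eqy x≢y y≡x rewrite eqx | eqy with x Fin.≟ y
  ... | yes x≡y = contradiction x≡y x≢y
  ... | no _ with rank y ℕ.<? rank x
  ... | yes y<x = contradiction y≡x (ℕ.<⇒≢ y<x)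
  ... | no _ with rank y ℕ.≟ rank x
  ... | yes _  = refl
  ... | no y≢x = contradiction y≡x y≢x

  private
    exact-exact-tight : ∀ {x y c d p p′} → con x ≡ eqc c p → con y ≡ eqc d p′
                      → TightCycle CG (suc x) (suc y)
    exact-exact-tight {c = c} {d} ex ey =
      tight le (zero ∷ []) (zero ∷ []) _ _
        (cong₂ _+ʷ_ (lower-eqc ex) (upper-eqc ey))
        (cong₂ _+ʷ_ (lower-eqc ey) (upper-eqc ex))
        (cancel (+ c) (+ d))
      where
      cancel : ∀ C D → (- C ℤ.+ D) ℤ.+ (- D ℤ.+ C) ≡ + 0
      cancel = solve-∀

    exact-open-tight : ∀ {x y c d p p′ q′} → con x ≡ eqc c p → con y ≡ openc (ℕ.suc d) p′ q′
                     → TightCycle CG (suc x) (suc y)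
    exact-open-tight {c = c} {d} ex ey =
      tight lt (zero ∷ []) (zero ∷ []) _ _
        (cong₂ _+ʷ_ (lower-eqc ex) (upper-openc ey))
        (cong₂ _+ʷ_ (lower-openc ey) (upper-eqc ex))
        (cancel (+ c) (+ d))
      where
      cancel : ∀ C D → (- C ℤ.+ (+ 1 ℤ.+ D)) ℤ.+ (- D ℤ.+ C) ≡ + 1
      cancel = solve-∀

    open-open-<-tight : ∀ {x y c d p q p′ q′}
                      → con x ≡ openc (ℕ.suc c) p q → con y ≡ openc (ℕ.suc d) p′ q′
                      → x ≢ y → rank y ℕ.< rank x → TightCycle CG (suc x) (suc y)
    open-open-<-tight {c = c} {d} ex ey x≢y y<x =
      tight lt [] (zero ∷ []) _ _
        (diagonal-< ex ey x≢y y<x)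
        (cong₂ _+ʷ_ (lower-openc ey) (upper-openc ex))
        (cancel (+ c) (+ d))
      where
      cancel : ∀ C D → ((+ 1 ℤ.+ D) - (+ 1 ℤ.+ C)) ℤ.+ (- D ℤ.+ (+ 1 ℤ.+ C)) ≡ + 1
      cancel = solve-∀

    open-open-≡-tight : ∀ {x y c d p q p′ q′}
                      → con x ≡ openc (ℕ.suc c) p q → con y ≡ openc (ℕ.suc d) p′ q′
                      → x ≢ y → rank y ≡ rank x → TightCycle CG (suc x) (suc y)
    open-open-≡-tight {c = c} {d} ex ey x≢y y≡x =
      tight le [] [] _ _
        (diagonal-≡ ex ey x≢y y≡x)
        (diagonal-≡ ey ex (x≢y ∘ sym) (sym y≡x))
        (cancel (+ c) (+ d))
      where
      cancel : ∀ C D → ((+ 1 ℤ.+ D) - (+ 1 ℤ.+ C)) ℤ.+ ((+ 1 ℤ.+ C) - (+ 1 ℤ.+ D)) ≡ + 0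
      cancel = solve-∀

  bounded⇒TightCycle : ∀ {x y} → Bounded R x → Bounded R y → TightCycle CG (suc x) (suc y)
  bounded⇒TightCycle (bnd-eq _ _ ex) (bnd-eq _ _ ey) = exact-exact-tight ex ey
  bounded⇒TightCycle (bnd-eq _ _ ex) (bnd-open (ℕ.suc _) (s≤s z≤n) _ ey) = exact-open-tight ex ey
  bounded⇒TightCycle (bnd-open (ℕ.suc _) (s≤s z≤n) _ ex) (bnd-eq _ _ ey) =
    TightCycle-swap (exact-open-tight ey ex)
  bounded⇒TightCycle {x} {y} (bnd-open (ℕ.suc _) (s≤s z≤n) _ ex) (bnd-open (ℕ.suc _) (s≤s z≤n) _ ey)
    with x Fin.≟ y
  ... | yes refl = tight le [] [] _ _ (diagonal-refl x) (diagonal-refl x) refl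
  ... | no x≢y with ℕ.<-cmp (rank y) (rank x)
  ...   | tri< y<x _ _ = open-open-<-tight ex ey x≢y y<x
  ...   | tri≈ _ y≡x _ = open-open-≡-tight ex ey x≢y y≡x
  ...   | tri> _ _ x<y = TightCycle-swap (open-open-<-tight ey ex (x≢y ∘ sym) x<y)

lemma2 : ∀ {n : ℕ} (α : Fin n → ℕ) (R : Region α) (GR : Graph n)
         → IsCanonicalOf (constraintGraph R) GR
         → (x₁ x₂ : Fin n) → Bounded R x₁ → Bounded R x₂
         → (G : Graph n)
         → G (suc x₁) (suc x₂) <ʷ GR (suc x₁) (suc x₂)
         → NegativeCycle2 (minG GR G) (suc x₁) (suc x₂)
lemma2 α R GR canonical x₁ x₂ bounded₁ bounded₂ G G<GR =
  TightCycle⇒negativeCycle2 canonical (bounded⇒TightCycle R bounded₁ bounded₂) G G<GR
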